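{- The smallest positive integer $k$ such that $\mathbb{Z}_3=\{x_1^2+x_2^2+\cdots+x_k^2:\ x_1,\dots,x_k\in\mathcal{C}_3\}$ is $k=4$.
   Context: $\mathbb{Z}_3$ is the ring of $3$-adic integers, and $\mathcal{C}_3=\left\{\sum_{n=0}^\infty a_n 3^n:\ a_n\in\{0,2\}\right\}\subseteq\mathbb{Z}_3$ (the $p$-adic Cantor set $\mathcal{C}_\gamma=\{\sum_{n\ge0}a_n\gamma^n: a_n\in\{0,\gamma-1\}\}$ with $p=\gamma=3$). -}

module Defs where

open import Data.Nat using (ℕ; zero; suc; _+_; _*_; _^_; _%_; _<_; _≤_)
open import Data.Nat.Properties using (m^n≢0)
open import Data.Fin using (Fin; toℕ)
open import Data.Product using (Σ; _×_)
open import Relation.Binary.PropositionalEquality using (_≡_; _≢_)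
open import Relation.Nullary using (¬_)

-- A 3-adic integer x = Σ_{n≥0} a_n 3^n, represented by its digit sequence
-- (a_n)_{n ≥ 0} with a_n ∈ {0,1,2}.  (Every element of ℤ₃ has a unique such expansion.)
ℤ₃ : Set
ℤ₃ = ℕ → Fin 3

trunc : ℤ₃ → ℕ → ℕ
trunc x zero    = 0
trunc x (suc n) = trunc x n + toℕ (x n) * 3 ^ n

InCantor : ℤ₃ → Set
InCantor x = ∀ n → toℕ (x n) ≢ 1

sumFin : ∀ k → (Fin k → ℕ) → ℕ
sumFin zero    f = 0
sumFin (suc k) f = f Data.Fin.zero + sumFin k (λ i → f (Data.Fin.suc i))

-- Equality in ℤ₃ of x and y₁² + … + y_k²: since ring operations on ℤ₃ are
-- computed levelwise, this holds iff for every n the two agree modulo 3^n.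
IsSumOfSquares : ∀ k → ℤ₃ → (Fin k → ℤ₃) → Set
IsSumOfSquares k x ys =
  ∀ n → _%_ (trunc x n) (3 ^ n) {{m^n≢0 3 n}}
        ≡ _%_ (sumFin k (λ i → trunc (ys i) n * trunc (ys i) n)) (3 ^ n) {{m^n≢0 3 n}}

EveryIsSumOfCantorSquares : ℕ → Set
EveryIsSumOfCantorSquares k =
  ∀ (x : ℤ₃) → Σ (Fin k → ℤ₃) (λ ys → (∀ i → InCantor (ys i)) × IsSumOfSquares k x ys)

IsLeastPositive : (ℕ → Set) → ℕ → Set
IsLeastPositive P k = (1 ≤ k) × P k × (∀ j → 1 ≤ j → j < k → ¬ P j)

-- Lower bound: a Cantor element is ≡ 0, 2, 6 or 8 modulo 9, so its square is ≡ 0, 4 or 1, and no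
-- sum of three such residues is 7; padding with zeros reduces fewer summands to three.
-- Upper bound: two of the four summands are the constants 0 or 2, chosen so that the sum is right
-- modulo 3.  The other two start at 2 and are refined digit by digit: if a ≡ 2 (mod 3) and 3 ∣ p,
-- then (a + d p)² ≡ a² + d p (mod 3p) for d ∈ {0, 2}, and the sums d₁ + d₂ ∈ {0, 2, 4} of two
-- Cantor digits run through all residues modulo 3, so the next digit of x can always be matched.
module Submission where

open import Data.Bool using (Bool; true; false)
open import Data.Fin using (Fin; toℕ) renaming (zero to fz; suc to fs)
open import Data.Fin.Properties using (toℕ<n; toℕ-fromℕ<)
open import Data.List using (List; []; _∷_)
open import Data.List.Membership.Propositional using (_∈_)
open import Data.List.Relation.Unary.All using (All; all?; lookup)
open import Data.List.Relation.Unary.Any using (here; there)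
open import Data.Nat
open import Data.Nat.DivMod
open import Data.Nat.Divisibility using (_∣_; n∣m⇒m%n≡0; m∣m*n; ∣n⇒∣m*n)
open import Data.Nat.Properties
open import Data.Nat.Tactic.RingSolver using (solve-∀)
open import Function using (_∘_)
open import Data.Product using (∃₂; _×_; _,_; proj₁; proj₂)
open import Relation.Binary.PropositionalEquality
open import Relation.Nullary using (¬_; ¬?; contradiction)
open import Relation.Nullary.Decidable using (from-yes)

open import Defs

-- The modulus used by IsSumOfSquares; instance search cannot find NonZero (3 ^ n) by itself.
_%3^_ : ℕ → ℕ → ℕ
m %3^ n = _%_ m (3 ^ n) {{m^n≢0 3 n}}

trunc<3^n : ∀ x n → trunc x n < 3 ^ n
trunc<3^n x zero    = s≤s z≤n
trunc<3^n x (suc n) = begin-strict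
  trunc x n + toℕ (x n) * 3 ^ n   <⟨ +-monoˡ-< (toℕ (x n) * 3 ^ n) (trunc<3^n x n) ⟩
  3 ^ n + toℕ (x n) * 3 ^ n       ≤⟨ +-monoʳ-≤ (3 ^ n) (*-monoˡ-≤ (3 ^ n) (≤-pred (toℕ<n (x n)))) ⟩
  3 * 3 ^ n                       ∎
  where open ≤-Reasoning

cantorDigit : Bool → Fin 3
cantorDigit false = fz
cantorDigit true  = fs (fs fz)

⟦_⟧ : Bool → ℕ
⟦ d ⟧ = toℕ (cantorDigit d)

cantorDigit≢1 : ∀ d → toℕ (cantorDigit d) ≢ 1
cantorDigit≢1 false ()
cantorDigit≢1 true  ()

digitPair-hits-residue : ∀ (r t : Fin 3) → ∃₂ λ d₁ d₂ → (toℕ r + (⟦ d₁ ⟧ + ⟦ d₂ ⟧)) % 3 ≡ toℕ t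
digitPair-hits-residue fz           fz           = false , false , refl
digitPair-hits-residue fz           (fs fz)      = true  , true  , refl
digitPair-hits-residue fz           (fs (fs fz)) = true  , false , refl
digitPair-hits-residue (fs fz)      fz           = true  , false , refl
digitPair-hits-residue (fs fz)      (fs fz)      = false , false , refl
digitPair-hits-residue (fs fz)      (fs (fs fz)) = true  , true  , refl
digitPair-hits-residue (fs (fs fz)) fz           = true  , true  , refl
digitPair-hits-residue (fs (fs fz)) (fs fz)      = true  , false , refl
digitPair-hits-residue (fs (fs fz)) (fs (fs fz)) = false , false , refl

digitPair-hits : ∀ q (t : Fin 3) → ∃₂ λ d₁ d₂ → (q + (⟦ d₁ ⟧ + ⟦ d₂ ⟧)) % 3 ≡ toℕ t
digitPair-hits q t with digitPair-hits-residue (q mod 3) t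
... | d₁ , d₂ , hit = d₁ , d₂ , (begin
  (q + s) % 3                   ≡⟨ %-distribˡ-+ q s 3 ⟩
  (q % 3 + s % 3) % 3           ≡⟨ cong (λ r → (r + s % 3) % 3) (m%n%n≡m%n q 3) ⟨
  (q % 3 % 3 + s % 3) % 3       ≡⟨ %-distribˡ-+ (q % 3) s 3 ⟨
  (q % 3 + s) % 3               ≡⟨ cong (λ r → (r + s) % 3) (toℕ-fromℕ< (m%n<n q 3)) ⟨
  (toℕ (q mod 3) + s) % 3       ≡⟨ hit ⟩
  toℕ t                         ∎)
  where
  open ≡-Reasoning
  s = ⟦ d₁ ⟧ + ⟦ d₂ ⟧

%-cong-+ˡ : ∀ {d m n} .{{_ : NonZero d}} q → m % d ≡ n % d → (q + m) % d ≡ (q + n) % d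
%-cong-+ˡ {d} {m} {n} q eq = begin
  (q + m) % d             ≡⟨ %-distribˡ-+ q m d ⟩
  (q % d + m % d) % d     ≡⟨ cong (λ r → (q % d + r) % d) eq ⟩
  (q % d + n % d) % d     ≡⟨ %-distribˡ-+ q n d ⟨
  (q + n) % d             ∎
  where open ≡-Reasoning

[x+m*p]%[3*p]≡[x+[m%3]*p]%[3*p] : ∀ x m p .{{_ : NonZero (3 * p)}} →
  (x + m * p) % (3 * p) ≡ (x + (m % 3) * p) % (3 * p)
[x+m*p]%[3*p]≡[x+[m%3]*p]%[3*p] x m p = begin
  (x + m * p) % (3 * p)                               ≡⟨ cong (λ k → (x + k * p) % (3 * p)) (m≡m%n+[m/n]*n m 3) ⟩
  (x + (m % 3 + m / 3 * 3) * p) % (3 * p)             ≡⟨ cong (_% (3 * p)) (regroup x (m % 3) (m / 3) p) ⟩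
  (x + (m % 3) * p + (m / 3) * (3 * p)) % (3 * p)     ≡⟨ [m+kn]%n≡m%n (x + (m % 3) * p) (m / 3) (3 * p) ⟩
  (x + (m % 3) * p) % (3 * p)                         ∎
  where
  open ≡-Reasoning
  regroup : ∀ x r k p → x + (r + k * 3) * p ≡ x + r * p + k * (3 * p)
  regroup = solve-∀

%[3*p]-cong : ∀ x m m′ p .{{_ : NonZero (3 * p)}} → m % 3 ≡ m′ % 3 →
  (x + m * p) % (3 * p) ≡ (x + m′ * p) % (3 * p)
%[3*p]-cong x m m′ p eq = begin
  (x + m * p) % (3 * p)           ≡⟨ [x+m*p]%[3*p]≡[x+[m%3]*p]%[3*p] x m p ⟩
  (x + (m % 3) * p) % (3 * p)     ≡⟨ cong (λ r → (x + r * p) % (3 * p)) eq ⟩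
  (x + (m′ % 3) * p) % (3 * p)    ≡⟨ [x+m*p]%[3*p]≡[x+[m%3]*p]%[3*p] x m′ p ⟨
  (x + m′ * p) % (3 * p)          ∎
  where open ≡-Reasoning

square-shift : ∀ a e p → (a + e * p) * (a + e * p) ≡ a * a + e * (2 * a + e * p) * p
square-shift = solve-∀

shift-term%3 : ∀ d {a p} → a % 3 ≡ 2 → 3 ∣ p → (⟦ d ⟧ * (2 * a + ⟦ d ⟧ * p)) % 3 ≡ ⟦ d ⟧
shift-term%3 false _ _ = refl
shift-term%3 true {a} {p} a≡2 3∣p = begin
  (2 * (2 * a + 2 * p)) % 3                           ≡⟨ %-distribˡ-* 2 (2 * a + 2 * p) 3 ⟩
  (2 * ((2 * a + 2 * p) % 3)) % 3                     ≡⟨ cong (λ r → (2 * r) % 3) (%-distribˡ-+ (2 * a) (2 * p) 3) ⟩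
  (2 * (((2 * a) % 3 + (2 * p) % 3) % 3)) % 3         ≡⟨ cong₂ (λ r s → (2 * ((r + s) % 3)) % 3) (%-distribˡ-* 2 a 3) (%-distribˡ-* 2 p 3) ⟩
  (2 * (((2 * (a % 3)) % 3 + (2 * (p % 3)) % 3) % 3)) % 3
                                                      ≡⟨ cong₂ (λ r s → (2 * (((2 * r) % 3 + (2 * s) % 3) % 3)) % 3) a≡2 (n∣m⇒m%n≡0 p 3 3∣p) ⟩
  2                                                   ∎
  where open ≡-Reasoning

lift-sumOfTwoSquares : ∀ p .{{_ : NonZero p}} .{{_ : NonZero (3 * p)}} a b c {X} (t : Fin 3) →
  3 ∣ p → a % 3 ≡ 2 → b % 3 ≡ 2 → X < p → X % p ≡ (a * a + (b * b + c)) % p →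
  ∃₂ λ d₁ d₂ → (X + toℕ t * p) % (3 * p)
               ≡ ((a + ⟦ d₁ ⟧ * p) * (a + ⟦ d₁ ⟧ * p) + ((b + ⟦ d₂ ⟧ * p) * (b + ⟦ d₂ ⟧ * p) + c)) % (3 * p)
lift-sumOfTwoSquares p a b c {X} t 3∣p a≡2 b≡2 X<p X≡S
  with digitPair-hits ((a * a + (b * b + c)) / p) t
... | d₁ , d₂ , hit = d₁ , d₂ , sym (begin
  S′ % (3 * p)                           ≡⟨ cong (_% (3 * p)) S′≡X+[q+T]p ⟩
  (X + (q + (T₁ + T₂)) * p) % (3 * p)    ≡⟨ %[3*p]-cong X (q + (T₁ + T₂)) (toℕ t) p q+T≡t ⟩
  (X + toℕ t * p) % (3 * p)              ∎)
  where
  open ≡-Reasoning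
  S = a * a + (b * b + c)
  q = S / p
  T₁ = ⟦ d₁ ⟧ * (2 * a + ⟦ d₁ ⟧ * p)
  T₂ = ⟦ d₂ ⟧ * (2 * b + ⟦ d₂ ⟧ * p)
  S′ = (a + ⟦ d₁ ⟧ * p) * (a + ⟦ d₁ ⟧ * p) + ((b + ⟦ d₂ ⟧ * p) * (b + ⟦ d₂ ⟧ * p) + c)

  S≡X+qp : S ≡ X + q * p
  S≡X+qp = begin
    S              ≡⟨ m≡m%n+[m/n]*n S p ⟩
    S % p + q * p  ≡⟨ cong (_+ q * p) (trans (sym X≡S) (m<n⇒m%n≡m X<p)) ⟩
    X + q * p      ∎

  S′≡X+[q+T]p : S′ ≡ X + (q + (T₁ + T₂)) * p
  S′≡X+[q+T]p = begin
    S′                                                   ≡⟨ cong₂ (λ u v → u + (v + c)) (square-shift a ⟦ d₁ ⟧ p) (square-shift b ⟦ d₂ ⟧ p) ⟩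
    a * a + T₁ * p + (b * b + T₂ * p + c)                ≡⟨ collect (a * a) (b * b) c T₁ T₂ p ⟩
    S + (T₁ + T₂) * p                                    ≡⟨ cong (_+ (T₁ + T₂) * p) S≡X+qp ⟩
    X + q * p + (T₁ + T₂) * p                            ≡⟨ +-assoc X (q * p) _ ⟩
    X + (q * p + (T₁ + T₂) * p)                          ≡⟨ cong (X +_) (*-distribʳ-+ p q (T₁ + T₂)) ⟨
    X + (q + (T₁ + T₂)) * p                              ∎
    where
    collect : ∀ A B c T₁ T₂ p → A + T₁ * p + (B + T₂ * p + c) ≡ A + (B + c) + (T₁ + T₂) * p
    collect = solve-∀

  T≡digits : (T₁ + T₂) % 3 ≡ (⟦ d₁ ⟧ + ⟦ d₂ ⟧) % 3
  T≡digits = begin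
    (T₁ + T₂) % 3            ≡⟨ %-distribˡ-+ T₁ T₂ 3 ⟩
    (T₁ % 3 + T₂ % 3) % 3    ≡⟨ cong₂ (λ u v → (u + v) % 3) (shift-term%3 d₁ {a} a≡2 3∣p) (shift-term%3 d₂ {b} b≡2 3∣p) ⟩
    (⟦ d₁ ⟧ + ⟦ d₂ ⟧) % 3    ∎

  q+T≡t : (q + (T₁ + T₂)) % 3 ≡ toℕ t % 3
  q+T≡t = begin
    (q + (T₁ + T₂)) % 3      ≡⟨ %-cong-+ˡ q T≡digits ⟩
    (q + (⟦ d₁ ⟧ + ⟦ d₂ ⟧)) % 3 ≡⟨ hit ⟩
    toℕ t                    ≡⟨ m<n⇒m%n≡m (toℕ<n t) ⟨
    toℕ t % 3                ∎

fromCantorDigits : (ℕ → Bool) → ℤ₃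
fromCantorDigits f n = cantorDigit (f n)

fromCantorDigits-InCantor : ∀ f → InCantor (fromCantorDigits f)
fromCantorDigits-InCantor f n = cantorDigit≢1 (f n)

onlyLeading : Bool → ℕ → Bool
onlyLeading d zero    = d
onlyLeading d (suc n) = false

trunc-onlyLeading : ∀ d n → trunc (fromCantorDigits (onlyLeading d)) (suc n) ≡ ⟦ d ⟧
trunc-onlyLeading d zero    = *-identityʳ ⟦ d ⟧
trunc-onlyLeading d (suc n) = trans (+-identityʳ _) (trunc-onlyLeading d n)

constantDigits : Fin 3 → Bool × Bool
constantDigits fz           = true  , false
constantDigits (fs fz)      = true  , true
constantDigits (fs (fs fz)) = false , false

squareSum : Bool × Bool → ℕ
squareSum (e₃ , e₄) = ⟦ e₃ ⟧ * ⟦ e₃ ⟧ + (⟦ e₄ ⟧ * ⟦ e₄ ⟧ + 0)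

constantDigits-sound : ∀ r → (0 + toℕ r * 1) % 3 ≡ (2 * 2 + (2 * 2 + squareSum (constantDigits r))) % 3
constantDigits-sound fz           = refl
constantDigits-sound (fs fz)      = refl
constantDigits-sound (fs (fs fz)) = refl

3∣3^[1+n] : ∀ n → 3 ∣ 3 ^ suc n
3∣3^[1+n] n = m∣m*n (3 ^ n)

[m+k*3^[1+n]]%3≡m%3 : ∀ m k n → (m + k * 3 ^ suc n) % 3 ≡ m % 3
[m+k*3^[1+n]]%3≡m%3 m k n = %-remove-+ʳ m (∣n⇒∣m*n k (3∣3^[1+n] n))

module FourCantorSquares (x : ℤ₃) where

  c : ℕ
  c = squareSum (constantDigits (x 0))

  sumOfSquares : ℕ → ℕ → ℕ
  sumOfSquares a b = a * a + (b * b + c)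

  record Approximation (n : ℕ) : Set where
    field
      a b    : ℕ
      a%3≡2  : a % 3 ≡ 2
      b%3≡2  : b % 3 ≡ 2
      agrees : trunc x (suc n) %3^ suc n ≡ sumOfSquares a b %3^ suc n
  open Approximation

  refine : ∀ {n} (s : Approximation n) → ∃₂ λ d₁ d₂ →
    trunc x (suc (suc n)) %3^ suc (suc n)
    ≡ sumOfSquares (a s + ⟦ d₁ ⟧ * 3 ^ suc n) (b s + ⟦ d₂ ⟧ * 3 ^ suc n) %3^ suc (suc n)
  refine {n} s = lift-sumOfTwoSquares (3 ^ suc n) {{m^n≢0 3 (suc n)}} {{m^n≢0 3 (suc (suc n))}}
    (a s) (b s) c (x (suc n))
    (3∣3^[1+n] n) (a%3≡2 s) (b%3≡2 s) (trunc<3^n x (suc n)) (agrees s)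

  approximation : ∀ n → Approximation n
  approximation zero = record
    { a = 2 ; b = 2 ; a%3≡2 = refl ; b%3≡2 = refl ; agrees = constantDigits-sound (x 0) }
  approximation (suc n) = record
    { a      = a s + ⟦ d₁ ⟧ * 3 ^ suc n
    ; b      = b s + ⟦ d₂ ⟧ * 3 ^ suc n
    ; a%3≡2  = trans ([m+k*3^[1+n]]%3≡m%3 (a s) ⟦ d₁ ⟧ n) (a%3≡2 s)
    ; b%3≡2  = trans ([m+k*3^[1+n]]%3≡m%3 (b s) ⟦ d₂ ⟧ n) (b%3≡2 s)
    ; agrees = proj₂ (proj₂ (refine s))
    }
    where
    s  = approximation n
    d₁ = proj₁ (refine s)
    d₂ = proj₁ (proj₂ (refine s))

  digits₁ digits₂ : ℕ → Bool
  digits₁ zero    = true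
  digits₁ (suc n) = proj₁ (refine (approximation n))
  digits₂ zero    = true
  digits₂ (suc n) = proj₁ (proj₂ (refine (approximation n)))

  trunc-digits₁ : ∀ n → trunc (fromCantorDigits digits₁) (suc n) ≡ a (approximation n)
  trunc-digits₁ zero    = refl
  trunc-digits₁ (suc n) = cong (_+ ⟦ digits₁ (suc n) ⟧ * 3 ^ suc n) (trunc-digits₁ n)

  trunc-digits₂ : ∀ n → trunc (fromCantorDigits digits₂) (suc n) ≡ b (approximation n)
  trunc-digits₂ zero    = refl
  trunc-digits₂ (suc n) = cong (_+ ⟦ digits₂ (suc n) ⟧ * 3 ^ suc n) (trunc-digits₂ n)

  digits : Fin 4 → ℕ → Bool
  digits fz                = digits₁
  digits (fs fz)           = digits₂
  digits (fs (fs fz))      = onlyLeading (proj₁ (constantDigits (x 0)))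
  digits (fs (fs (fs fz))) = onlyLeading (proj₂ (constantDigits (x 0)))

  summands : Fin 4 → ℤ₃
  summands i = fromCantorDigits (digits i)

  sum≡approximation : ∀ n → sumFin 4 (λ i → trunc (summands i) (suc n) * trunc (summands i) (suc n))
                            ≡ sumOfSquares (a (approximation n)) (b (approximation n))
  sum≡approximation n
    rewrite trunc-digits₁ n | trunc-digits₂ n
          | trunc-onlyLeading (proj₁ (constantDigits (x 0))) n
          | trunc-onlyLeading (proj₂ (constantDigits (x 0))) n = refl

  isSumOfSquares : IsSumOfSquares 4 x summands
  isSumOfSquares zero    = refl
  isSumOfSquares (suc n) = trans (agrees (approximation n)) (cong (_%3^ suc n) (sym (sum≡approximation n)))

everyIsSumOfFourCantorSquares : EveryIsSumOfCantorSquares 4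
everyIsSumOfFourCantorSquares x =
  summands , (λ i → fromCantorDigits-InCantor (digits i)) , isSumOfSquares
  where open FourCantorSquares x

0ℤ₃ : ℤ₃
0ℤ₃ = fromCantorDigits (λ _ → false)

trunc-0ℤ₃ : ∀ n → trunc 0ℤ₃ n ≡ 0
trunc-0ℤ₃ zero    = refl
trunc-0ℤ₃ (suc n) = trans (+-identityʳ _) (trunc-0ℤ₃ n)

everyIsSumOfCantorSquares-suc : ∀ {k} → EveryIsSumOfCantorSquares k → EveryIsSumOfCantorSquares (suc k)
everyIsSumOfCantorSquares-suc {k} every x with every x
... | ys , ys∈𝒞 , x≡Σys² = zs , zs∈𝒞 , x≡Σzs²
  where
  zs : Fin (suc k) → ℤ₃
  zs fz     = 0ℤ₃
  zs (fs i) = ys i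

  zs∈𝒞 : ∀ i → InCantor (zs i)
  zs∈𝒞 fz     = fromCantorDigits-InCantor _
  zs∈𝒞 (fs i) = ys∈𝒞 i

  x≡Σzs² : IsSumOfSquares (suc k) x zs
  x≡Σzs² n rewrite trunc-0ℤ₃ n = x≡Σys² n

everyIsSumOfCantorSquares-mono : ∀ {j k} → j ≤′ k → EveryIsSumOfCantorSquares j → EveryIsSumOfCantorSquares k
everyIsSumOfCantorSquares-mono (≤′-reflexive refl) = λ every → every
everyIsSumOfCantorSquares-mono (≤′-step j≤′k)      = everyIsSumOfCantorSquares-suc ∘ everyIsSumOfCantorSquares-mono j≤′k

cantorResidues9 : List ℕ
cantorResidues9 = 0 ∷ 2 ∷ 6 ∷ 8 ∷ []

twoCantorDigits∈cantorResidues9 : ∀ (r s : Fin 3) → toℕ r ≢ 1 → toℕ s ≢ 1 →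
  0 + toℕ r * 1 + toℕ s * 3 ∈ cantorResidues9
twoCantorDigits∈cantorResidues9 fz           fz           _ _ = here refl
twoCantorDigits∈cantorResidues9 (fs (fs fz)) fz           _ _ = there (here refl)
twoCantorDigits∈cantorResidues9 fz           (fs (fs fz)) _ _ = there (there (here refl))
twoCantorDigits∈cantorResidues9 (fs (fs fz)) (fs (fs fz)) _ _ = there (there (there (here refl)))
twoCantorDigits∈cantorResidues9 (fs fz)      _            r≢1 _ = contradiction refl r≢1
twoCantorDigits∈cantorResidues9 _            (fs fz)      _ s≢1 = contradiction refl s≢1

trunc2∈cantorResidues9 : ∀ y → InCantor y → trunc y 2 ∈ cantorResidues9
trunc2∈cantorResidues9 y y∈𝒞 = twoCantorDigits∈cantorResidues9 (y 0) (y 1) (y∈𝒞 0) (y∈𝒞 1)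

threeSquares%9≢7 : All (λ r → All (λ s → All (λ t → (r * r + (s * s + (t * t + 0))) % 9 ≢ 7)
                     cantorResidues9) cantorResidues9) cantorResidues9
threeSquares%9≢7 = from-yes (all? (λ r → all? (λ s → all? (λ t → ¬? ((r * r + (s * s + (t * t + 0))) % 9 ≟ 7))
                     cantorResidues9) cantorResidues9) cantorResidues9)

seven : ℤ₃
seven zero          = fs fz
seven (suc zero)    = fs (fs fz)
seven (suc (suc n)) = fz

¬everyIsSumOfThreeCantorSquares : ¬ EveryIsSumOfCantorSquares 3
¬everyIsSumOfThreeCantorSquares every with every seven
... | ys , ys∈𝒞 , seven≡Σys² =
  lookup (lookup (lookup threeSquares%9≢7 (residue fz)) (residue (fs fz))) (residue (fs (fs fz)))
    (sym (seven≡Σys² 2))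
  where
  residue : ∀ i → trunc (ys i) 2 ∈ cantorResidues9
  residue i = trunc2∈cantorResidues9 (ys i) (ys∈𝒞 i)

corollary7p4 : IsLeastPositive EveryIsSumOfCantorSquares 4
corollary7p4 = s≤s z≤n , everyIsSumOfFourCantorSquares , fewerFail
  where
  fewerFail : ∀ j → 1 ≤ j → j < 4 → ¬ EveryIsSumOfCantorSquares j
  fewerFail j _ j<4 = ¬everyIsSumOfThreeCantorSquares ∘ everyIsSumOfCantorSquares-mono (≤⇒≤′ (≤-pred j<4))
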